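{- Let $P$ be a poset with inconsistent pairs and let $S(P)$ be the graph whose vertices are the consistent order ideals of $P$, two ideals being adjacent if they differ by a single element. Let $p \nleftrightarrow q$ be an inconsistent pair of $P$, and let $S(P)_{p \nleftrightarrow q}$ be the set of vertices whose consistent order ideals contain neither $p$ nor $q$, $S(P)_p$ the set of vertices whose ideals contain $p$, and $S(P)_q$ the set of vertices whose ideals contain $q$. Then $S(P)_{p \nleftrightarrow q}$ is a bottleneck (vertex separator) for $S(P)$ that separates the sets $S(P)_p$ and $S(P)_q$ from each other: these three sets partition the vertex set, and no vertex of $S(P)_p$ is adjacent to a vertex of $S(P)_q$.
   Context: A poset with inconsistent pairs (PIP) is a finite poset $P$ together with a collection of unordered pairs $\{p,q\}$, called inconsistent and written $p\nleftrightarrow q$, such that: (1) if $p\nleftrightarrow q$ then there is no $r\in P$ with $r\ge p$ and $r\ge q$; (2) if $p\nleftrightarrow q$, $p'\ge p$ and $q'\ge q$, then $p'\nleftrightarrow q'$. An order ideal (downset) is a subset $I\subseteq P$ such that $a\le b$ and $b\in I$ imply $a\in I$; it is consistent if it contains no inconsistent pair. A set $T$ of vertices of a connected graph is a vertex separator (bottleneck) if removing $T$ and its incident edges disconnects the graph. -}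

module Defs where

open import Level using (0ℓ)
open import Data.Nat using (ℕ)
open import Data.Fin using (Fin)
open import Data.Fin.Subset using (Subset; _∈_; _∉_)
open import Data.Product using (Σ; ∃; _×_; _,_)
open import Data.Sum using (_⊎_)
open import Relation.Nullary using (¬_)
open import Relation.Binary.PropositionalEquality using (_≡_; _≢_)
open import Relation.Binary.Structures using (IsPartialOrder)

record PIP : Set₁ where
  field
    n        : ℕ
    _≤_      : Fin n → Fin n → Set
    isPO     : IsPartialOrder _≡_ _≤_
    Inc      : Fin n → Fin n → Set
    Inc-sym  : ∀ {p q} → Inc p q → Inc q p
    Inc-noUB : ∀ {p q} → Inc p q → ∀ r → ¬ (p ≤ r × q ≤ r)
    Inc-up   : ∀ {p q p' q'} → Inc p q → p ≤ p' → q ≤ q' → Inc p' q'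

module _ (P : PIP) where
  open PIP P

  IsIdeal : Subset n → Set
  IsIdeal I = ∀ {a b} → a ≤ b → b ∈ I → a ∈ I

  IsConsistent : Subset n → Set
  IsConsistent I = ∀ {a b} → Inc a b → ¬ (a ∈ I × b ∈ I)

  Vertex : Set
  Vertex = Σ (Subset n) λ I → IsIdeal I × IsConsistent I

  Adjacent : Vertex → Vertex → Set
  Adjacent (I , _) (J , _) =
    ∃ λ x → ((x ∈ I × x ∉ J) ⊎ (x ∉ I × x ∈ J))
          × (∀ y → y ≢ x → (y ∈ I → y ∈ J) × (y ∈ J → y ∈ I))

  InNeither : Fin n → Fin n → Vertex → Set
  InNeither p q (I , _) = p ∉ I × q ∉ I

  InS : Fin n → Vertex → Set
  InS p (I , _) = p ∈ I

Fin' : PIP → Set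
Fin' P = Fin (PIP.n P)

{-# OPTIONS --safe #-}
module Submission where

open import Defs
open import Data.Product using (_×_; _,_; proj₁; proj₂)
open import Data.Sum using (_⊎_; inj₁; inj₂)
open import Relation.Nullary using (¬_; yes; no; contradiction)
open import Data.Fin using (_≟_)
open import Data.Fin.Subset.Properties using (_∈?_)
open import Relation.Binary.PropositionalEquality using (_≢_; refl; sym)
open import Relation.Binary.Structures using (IsPartialOrder)

-- Two adjacent ideals differ only in one element x, and p ≠ q because an
-- inconsistent pair has no common upper bound.  So if p lies in one ideal and
-- q in the other, one of the two ideals contains both p and q, contradicting
-- consistency.

module _ (P : PIP) where
  open PIP P
  open IsPartialOrder isPO using () renaming (refl to ≤-refl)

  Inc-irreflexive : ∀ {p q} → Inc p q → p ≢ q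
  Inc-irreflexive inc refl = Inc-noUB inc _ (≤-refl , ≤-refl)

  Vertex-trichotomy : ∀ p q (v : Vertex P) → InNeither P p q v ⊎ InS P p v ⊎ InS P q v
  Vertex-trichotomy p q (I , _) with p ∈? I | q ∈? I
  ... | yes p∈I | _       = inj₂ (inj₁ p∈I)
  ... | no _    | yes q∈I = inj₂ (inj₂ q∈I)
  ... | no p∉I  | no q∉I  = inj₁ (p∉I , q∉I)

  Adjacent⇒InS-shared : ∀ {a b} (u v : Vertex P) → Adjacent P u v → a ≢ b →
                        InS P a u → InS P b v → InS P a v ⊎ InS P b u
  Adjacent⇒InS-shared {a} {b} _ _ (x , _ , agree) a≢b a∈I b∈J with a ≟ x | b ≟ x
  ... | no a≢x   | _       = inj₁ (proj₁ (agree a a≢x) a∈I)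
  ... | yes _    | no b≢x  = inj₂ (proj₂ (agree b b≢x) b∈J)
  ... | yes refl | yes b≡a = contradiction (sym b≡a) a≢b

  InS-Inc-disjoint : ∀ {p q} → Inc p q → (v : Vertex P) → ¬ (InS P p v × InS P q v)
  InS-Inc-disjoint inc (_ , _ , consistent) = consistent inc

  InS-Inc-nonadjacent : ∀ {p q} → Inc p q → (u v : Vertex P) →
                        InS P p u → InS P q v → ¬ Adjacent P u v
  InS-Inc-nonadjacent inc u v p∈I q∈J adj
    with Adjacent⇒InS-shared u v adj (Inc-irreflexive inc) p∈I q∈J
  ... | inj₁ p∈J = InS-Inc-disjoint inc v (p∈J , q∈J)
  ... | inj₂ q∈I = InS-Inc-disjoint inc u (p∈I , q∈I)

lemma3p11 : (P : PIP) → (p q : Fin' P) → PIP.Inc P p q →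
    ((v : Vertex P) → InNeither P p q v ⊎ InS P p v ⊎ InS P q v)
    × ((v : Vertex P) → ¬ (InNeither P p q v × InS P p v))
    × ((v : Vertex P) → ¬ (InNeither P p q v × InS P q v))
    × ((v : Vertex P) → ¬ (InS P p v × InS P q v))
    × ((u v : Vertex P) → InS P p u → InS P q v → ¬ Adjacent P u v)
lemma3p11 P p q inc =
    Vertex-trichotomy P p q
  , (λ _ ((p∉ , _) , p∈) → p∉ p∈)
  , (λ _ ((_ , q∉) , q∈) → q∉ q∈)
  , InS-Inc-disjoint P inc
  , InS-Inc-nonadjacent P inc
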